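{- Let $n,d \in \mathbb{N}$, and let $A \subset \mathbb{Z}^d(n)$ with $|A| < 2n$. Then either $|\partial A| \geqslant |A|$, or $A$ contains a line.
   Context: For $n,d \in \mathbb{N}_0$, $\mathbb{Z}^d(n) = \{x \in \mathbb{Z}^d : x_i \geqslant 0 \text{ for all } i,\ \sum_i x_i = n\}$. For $x,y \in \mathbb{Z}^d$, $x \leqslant y$ means $x_i \leqslant y_i$ for every $i$. The shadow of $A \subset \mathbb{Z}^d(n)$ is $\partial A = \{x \in \mathbb{Z}^d(n-1) : x \leqslant y \text{ for some } y \in A\}$. A line in $\mathbb{Z}^d(n)$ is a set of the form $\{x \in \mathbb{Z}^d(n) : x_i = 0 \text{ for all } i \notin \{j,k\}\}$ for some distinct $j,k \in [d]$ (so a line has $n+1$ elements). -}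

module Defs where

open import Data.Nat using (ℕ; _+_; _≤_)
open import Data.Fin using (Fin)
open import Data.Vec using (Vec; lookup; sum)
open import Data.List using (List; length)
open import Data.List.Membership.Propositional using (_∈_)
open import Data.List.Relation.Unary.All using (All)
open import Data.List.Relation.Unary.Unique.Propositional using (Unique)
open import Data.Product using (Σ; _×_; ∃; ∃-syntax)
open import Relation.Binary.PropositionalEquality using (_≡_; _≢_)

-- Points of ℤ^d with nonnegative coordinates are represented as Vec ℕ d.
Point : ℕ → Set
Point d = Vec ℕ d

InLayer : ∀ {d} → ℕ → Point d → Set
InLayer n x = sum x ≡ n

_≤ᵖ_ : ∀ {d} → Point d → Point d → Set
x ≤ᵖ y = ∀ i → lookup x i ≤ lookup y i

-- A finite set A ⊂ ℤ^d(n): a duplicate-free list all of whose elements lie in ℤ^d(n).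
-- Its cardinality |A| is the length of the list.
IsSubsetOfLayer : ∀ {d} → ℕ → List (Point d) → Set
IsSubsetOfLayer n A = Unique A × All (InLayer n) A

-- x ∈ ∂A  (A ⊂ ℤ^d(n)):  x ∈ ℤ^d(n-1) and x ≤ y for some y ∈ A.
-- "x ∈ ℤ^d(n-1)" is written sum x + 1 ≡ n so that ℤ^d(-1) = ∅ when n = 0.
InShadow : ∀ {d} → ℕ → List (Point d) → Point d → Set
InShadow n A x = (sum x + 1 ≡ n) × (∃[ y ] (y ∈ A × x ≤ᵖ y))

ShadowSizeAtLeast : ∀ {d} → ℕ → List (Point d) → ℕ → Set
ShadowSizeAtLeast {d} n A k =
  ∃[ S ] (Unique S × All (InShadow n A) S × k ≤ length S)

ContainsLine : ∀ {d} → ℕ → List (Point d) → Set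
ContainsLine {d} n A =
  ∃[ j ] ∃[ k ] (j ≢ k ×
    (∀ (x : Point d) → InLayer n x →
       (∀ i → i ≢ j → i ≢ k → lookup x i ≡ 0) → x ∈ A))

module Submission where

-- Proof by induction on n and, for fixed n, on d.  Split B ⊂ ℤ^{1+d}(m+1) by its first
-- coordinate into the base S = {y : (0,y) ∈ B} ⊂ ℤ^d(m+1) and the lowered part
-- U = {x − e₀ : x ∈ B, x₀ ≥ 1} ⊂ ℤ^{1+d}(m), so |B| = |S| + |U| ≤ 2m+1.  Then ∂B contains
-- U, and also the disjoint union of {0} × (∂S ∪ {y : (0,y) ∈ U}) and e₀ + ∂U.  The
-- induction hypothesis applies to S, and to U when |U| < 2m.  Cases:
--   S = ∅: U ⊆ ∂B suffices.
--   |∂U| ≥ |U|: add |∂S| ≥ |S| (a line of S is a line of B).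
--   U contains a line: a second line would force |U| ≥ 2m+1, so the hypothesis for U minus
--     a point of the line gives |∂U| ≥ |U| − 1; one more point comes from the copy of the
--     line in the face x₀ = 0, or, for a line through e₀, from the vertex (0, (m+1)·e_k).
--   |U| ≥ 2m: then S = {t}; either t has two positive coordinates (two shadow points), or t
--     is a vertex, and walking along a line from it yields a line of B or a new shadow point.

open import Defs
open import Data.Nat using (ℕ; zero; suc; pred; _+_; _*_; _∸_; _≤_; _<_; z≤n; s≤s; s≤s⁻¹; _≟_; _<?_)
open import Data.Nat.Properties
open import Data.Fin using (Fin; zero; suc) renaming (_≟_ to _≟ᶠ_)
import Data.Fin.Properties as Fin
open import Data.Vec using ([]; _∷_; lookup; sum; replicate; updateAt; tail)
open import Data.Vec.Properties using (lookup∘updateAt; lookup∘updateAt′; lookup-replicate; ≡-dec)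
open import Data.List using (List; []; _∷_; length; map; _++_; downFrom)
open import Data.List.Properties using (length-map; length-++; length-downFrom; length-removeAt′)
open import Data.List.Membership.Propositional using (_∈_; _∉_)
open import Data.List.Membership.Propositional.Properties using (∈-downFrom⁻)
import Data.List.Membership.DecPropositional as DecMembership
open import Data.List.Relation.Unary.Any using (here; there; _─_; index)
open import Data.List.Relation.Unary.All as All using (All; []; _∷_)
import Data.List.Relation.Unary.All.Properties as AllP
open import Data.List.Relation.Unary.Unique.Propositional using (Unique; []; _∷_)
open import Data.List.Relation.Unary.Unique.Propositional.Properties using (map⁺; ++⁺; downFrom⁺; Unique[x∷xs]⇒x∉xs)
open import Data.Product using (_×_; _,_; proj₁; proj₂; ∃; ∃-syntax)
open import Data.Sum using (_⊎_; inj₁; inj₂; [_,_]′)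
open import Data.Empty using (⊥; ⊥-elim)
open import Function using (_∘_)
open import Relation.Nullary using (¬_; Dec; yes; no)
open import Relation.Unary using (Decidable)
open import Relation.Binary.PropositionalEquality
open import Algebra.Properties.CommutativeSemigroup +-commutativeSemigroup using (xy∙z≈xz∙y)

-- Counting distinct witnesses

AtLeast : {X : Set} → (X → Set) → ℕ → Set
AtLeast P k = ∃[ S ] (Unique S × All P S × k ≤ length S)

module _ {X : Set} where

  unique-∷ : {x : X} {xs : List X} → x ∉ xs → Unique xs → Unique (x ∷ xs)
  unique-∷ {xs = xs} x∉xs u = AllP.¬Any⇒All¬ xs x∉xs ∷ u

  ∈-─⁻ : {u x : X} {xs : List X} (p : u ∈ xs) → x ∈ (xs ─ p) → x ∈ xs
  ∈-─⁻ (here _)  m         = there m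
  ∈-─⁻ (there p) (here e)  = here e
  ∈-─⁻ (there p) (there m) = there (∈-─⁻ p m)

  ∈-─⁺ : {u x : X} {xs : List X} (p : u ∈ xs) → x ∈ xs → x ≢ u → x ∈ (xs ─ p)
  ∈-─⁺ (here refl) (here refl) x≢u = ⊥-elim (x≢u refl)
  ∈-─⁺ (here _)    (there m)   _   = m
  ∈-─⁺ (there p)   (here e)    _   = here e
  ∈-─⁺ (there p)   (there m)   x≢u = there (∈-─⁺ p m x≢u)

  unique-─ : {u : X} {xs : List X} → Unique xs → (p : u ∈ xs) → Unique (xs ─ p)
  unique-─ (_ ∷ u) (here _)  = u
  unique-─ (h ∷ u) (there p) = AllP.─⁺ p h ∷ unique-─ u p

  ∉-─ : {u : X} {xs : List X} → Unique xs → (p : u ∈ xs) → u ∉ (xs ─ p)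
  ∉-─ u       (here refl)             = Unique[x∷xs]⇒x∉xs u
  ∉-─ (h ∷ u) (there p)   (here refl) = All.lookup h p refl
  ∉-─ (h ∷ u) (there p)   (there m)   = ∉-─ u p m

  subset-length : {xs ys : List X} → Unique xs → (∀ {x} → x ∈ xs → x ∈ ys) → length xs ≤ length ys
  subset-length {[]}     _           _   = z≤n
  subset-length {x ∷ xs} {ys} (x∉ ∷ u) sub = begin
    suc (length xs)       ≤⟨ s≤s (subset-length u (λ m → ∈-─⁺ p (sub (there m)) (λ e → All.lookup x∉ m (sym e)))) ⟩
    suc (length (ys ─ p)) ≡⟨ length-removeAt′ ys (index p) ⟨
    length ys             ∎
    where
    open ≤-Reasoning
    p = sub (here refl)

  atLeast-∈ : {ys : List X} {k : ℕ} → AtLeast (_∈ ys) k → k ≤ length ys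
  atLeast-∈ (S , u , a , k≤) = ≤-trans k≤ (subset-length u (All.lookup a))

  atLeast-weaken : {P : X → Set} {j k : ℕ} → j ≤ k → AtLeast P k → AtLeast P j
  atLeast-weaken j≤k (S , u , a , k≤) = S , u , a , ≤-trans j≤k k≤

  atLeast-mono : {P Q : X → Set} {k : ℕ} → (∀ {x} → P x → Q x) → AtLeast P k → AtLeast Q k
  atLeast-mono f (S , u , a , k≤) = S , u , All.map f a , k≤

  atLeast-image : {Y : Set} {P : X → Set} {Q : Y → Set} {k : ℕ} (f : X → Y) →
                  (∀ {x y} → f x ≡ f y → x ≡ y) → (∀ {x} → P x → Q (f x)) →
                  AtLeast P k → AtLeast Q k
  atLeast-image f inj pq (S , u , a , k≤) =
    map f S , map⁺ inj u , AllP.map⁺ (All.map pq a) , subst (_ ≤_) (sym (length-map f S)) k≤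

  atLeast-union : {P Q : X → Set} {j k : ℕ} → (∀ {x} → P x → Q x → ⊥) →
                  AtLeast P j → AtLeast Q k → AtLeast (λ x → P x ⊎ Q x) (j + k)
  atLeast-union apart (S , uS , aS , j≤) (T , uT , aT , k≤) =
    S ++ T ,
    ++⁺ uS uT (λ (s , t) → apart (All.lookup aS s) (All.lookup aT t)) ,
    AllP.++⁺ (All.map inj₁ aS) (All.map inj₂ aT) ,
    subst (_ ≤_) (sym (length-++ S)) (+-mono-≤ j≤ k≤)

atLeast-below : (n : ℕ) → AtLeast (_< n) n
atLeast-below n = downFrom n , downFrom⁺ n , All.tabulate ∈-downFrom⁻ , ≤-reflexive (sym (length-downFrom n))

-- Points and lines of ℤ^d(n)

≤ᵖ-refl : ∀ {d} (x : Point d) → x ≤ᵖ x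
≤ᵖ-refl x i = ≤-refl

≤ᵖ-∷ : ∀ {d a b} {x y : Point d} → a ≤ b → x ≤ᵖ y → (a ∷ x) ≤ᵖ (b ∷ y)
≤ᵖ-∷ a≤b x≤y zero    = a≤b
≤ᵖ-∷ a≤b x≤y (suc i) = x≤y i

addAt : ∀ {d} → Point d → Fin d → ℕ → Point d
addAt x k c = updateAt x k (_+ c)

sum-addAt : ∀ {d} (x : Point d) (k : Fin d) (c : ℕ) → sum (addAt x k c) ≡ sum x + c
sum-addAt (a ∷ x) zero    c = xy∙z≈xz∙y a c (sum x)
sum-addAt (a ∷ x) (suc k) c = trans (cong (a +_) (sum-addAt x k c)) (sym (+-assoc a (sum x) c))

unit : ∀ {d} → Fin d → ℕ → Point d
unit k c = addAt (replicate _ 0) k c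

sum-replicate-0 : ∀ d → sum (replicate d 0) ≡ 0
sum-replicate-0 zero    = refl
sum-replicate-0 (suc d) = sum-replicate-0 d

sum-unit : ∀ {d} (k : Fin d) (c : ℕ) → sum (unit k c) ≡ c
sum-unit {d} k c = trans (sum-addAt (replicate d 0) k c) (cong (_+ c) (sum-replicate-0 d))

lookup-unit-same : ∀ {d} (k : Fin d) (c : ℕ) → lookup (unit k c) k ≡ c
lookup-unit-same k c = trans (lookup∘updateAt k (replicate _ 0)) (cong (_+ c) (lookup-replicate k 0))

lookup-unit-other : ∀ {d} {i k : Fin d} (c : ℕ) → i ≢ k → lookup (unit k c) i ≡ 0
lookup-unit-other {i = i} {k} c i≢k = trans (lookup∘updateAt′ i k i≢k (replicate _ 0)) (lookup-replicate i 0)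

all-zero : ∀ {d} (x : Point d) → (∀ i → lookup x i ≡ 0) → x ≡ replicate d 0
all-zero []      _ = refl
all-zero (a ∷ x) h = cong₂ _∷_ (h zero) (all-zero x (h ∘ suc))

sum-all-zero : ∀ {d} (x : Point d) → (∀ i → lookup x i ≡ 0) → sum x ≡ 0
sum-all-zero {d} x h = trans (cong sum (all-zero x h)) (sum-replicate-0 d)

single-support : ∀ {d} (k : Fin d) (x : Point d) → (∀ i → i ≢ k → lookup x i ≡ 0) → x ≡ unit k (sum x)
single-support {suc d} zero (a ∷ x) h
  rewrite all-zero x (λ i → h (suc i) (λ ())) | sum-replicate-0 d | +-identityʳ a = refl
single-support (suc k) (a ∷ x) h with h zero (λ ())
... | refl = cong (0 ∷_) (single-support k x (λ i i≢k → h (suc i) (i≢k ∘ Fin.suc-injective)))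

OnLine : ∀ {d} → Fin d → Fin d → Point d → Set
OnLine j k x = ∀ i → i ≢ j → i ≢ k → lookup x i ≡ 0

Line : ∀ {d} → Fin d → Fin d → ℕ → List (Point d) → Set
Line j k m A = ∀ x → InLayer m x → OnLine j k x → x ∈ A

line-swap : ∀ {d m} {j k : Fin d} {A : List (Point d)} → Line j k m A → Line k j m A
line-swap line x x∈ on = line x x∈ (λ i i≢k i≢j → on i i≢j i≢k)

line-⊆ : ∀ {d m} {j k : Fin d} {A A′ : List (Point d)} →
         (∀ {x} → x ∈ A → x ∈ A′) → Line j k m A → Line j k m A′
line-⊆ sub line x x∈ on = sub (line x x∈ on)

linePt : ∀ {d} → Fin d → Fin d → ℕ → ℕ → Point d
linePt j k a b = addAt (unit j a) k b

linePt-layer : ∀ {d m a} (j k : Fin d) → a ≤ m → InLayer m (linePt j k a (m ∸ a))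
linePt-layer {m = m} {a} j k a≤m =
  trans (sum-addAt (unit j a) k (m ∸ a)) (trans (cong (_+ (m ∸ a)) (sum-unit j a)) (m+[n∸m]≡n a≤m))

linePt-onLine : ∀ {d a b} (j k : Fin d) → OnLine j k (linePt j k a b)
linePt-onLine {a = a} j k i i≢j i≢k = trans (lookup∘updateAt′ i k i≢k (unit j a)) (lookup-unit-other a i≢j)

linePt-j : ∀ {d a b} {j k : Fin d} → j ≢ k → lookup (linePt j k a b) j ≡ a
linePt-j {a = a} {j = j} {k} j≢k = trans (lookup∘updateAt′ j k j≢k (unit j a)) (lookup-unit-same j a)

LinePoint : ∀ {d} → Fin d → Fin d → ℕ → Point d → Set
LinePoint j k m x = InLayer m x × OnLine j k x

line-points : ∀ {d m} {j k : Fin d} → j ≢ k → AtLeast (LinePoint j k m) (suc m)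
line-points {m = m} {j} {k} j≢k =
  atLeast-image (λ a → linePt j k a (m ∸ a)) injective
    (λ a<1+m → linePt-layer j k (s≤s⁻¹ a<1+m) , linePt-onLine j k) (atLeast-below (suc m))
  where
  injective : ∀ {a b} → linePt j k a (m ∸ a) ≡ linePt j k b (m ∸ b) → a ≡ b
  injective e = trans (sym (linePt-j j≢k)) (trans (cong (λ x → lookup x j) e) (linePt-j j≢k))

line-points-positive : ∀ {d m} {j k : Fin d} → j ≢ k →
                       AtLeast (λ x → LinePoint j k m x × 1 ≤ lookup x j) m
line-points-positive {m = m} {j} {k} j≢k =
  atLeast-image (λ a → linePt j k (suc a) (m ∸ suc a)) injective
    (λ a<m → (linePt-layer j k a<m , linePt-onLine j k) , subst (1 ≤_) (sym (linePt-j j≢k)) (s≤s z≤n))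
    (atLeast-below m)
  where
  injective : ∀ {a b} → linePt j k (suc a) (m ∸ suc a) ≡ linePt j k (suc b) (m ∸ suc b) → a ≡ b
  injective e = suc-injective (trans (sym (linePt-j j≢k)) (trans (cong (λ x → lookup x j) e) (linePt-j j≢k)))

line-atLeast : ∀ {d m} {j k : Fin d} {A : List (Point d)} → j ≢ k → Line j k m A → AtLeast (_∈ A) (suc m)
line-atLeast j≢k line = atLeast-mono (λ {x} (x∈ , on) → line x x∈ on) (line-points j≢k)

line-size : ∀ {d m} {j k : Fin d} {A : List (Point d)} → j ≢ k → Line j k m A → suc m ≤ length A
line-size j≢k line = atLeast-∈ (line-atLeast j≢k line)

-- Two lines whose coordinate pairs differ in j′ share no point with positive j′-coordinate,
-- so together they have at least 2m+1 points.
two-lines : ∀ {d m} {j k j′ k′ : Fin d} {A : List (Point d)} → j ≢ k → j′ ≢ k′ → j′ ≢ j → j′ ≢ k →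
            Line j k m A → Line j′ k′ m A → suc m + m ≤ length A
two-lines {m = m} {j} {k} {j′} {k′} {A} j≢k j′≢k′ j′≢j j′≢k line line′ =
  atLeast-∈ (atLeast-mono (λ {x} → inA {x}) (atLeast-union (λ {x} → apart {x}) (line-points j≢k) (line-points-positive j′≢k′)))
  where
  apart : ∀ {x} → LinePoint j k m x → LinePoint j′ k′ m x × 1 ≤ lookup x j′ → ⊥
  apart (_ , on) (_ , pos) = 1+n≰n (subst (1 ≤_) (on j′ j′≢j j′≢k) pos)
  inA : ∀ {x} → LinePoint j k m x ⊎ (LinePoint j′ k′ m x × 1 ≤ lookup x j′) → x ∈ A
  inA {x} (inj₁ (x∈ , on))       = line x x∈ on
  inA {x} (inj₂ ((x∈ , on) , _)) = line′ x x∈ on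

pair-cases : ∀ {d} (j k j′ k′ : Fin d) → j′ ≢ k′ →
             (∀ {x} → OnLine j k x → OnLine j′ k′ x) ⊎ ((j′ ≢ j × j′ ≢ k) ⊎ (k′ ≢ j × k′ ≢ k))
pair-cases j k j′ k′ j′≢k′ with j′ ≟ᶠ j | j′ ≟ᶠ k | k′ ≟ᶠ j | k′ ≟ᶠ k
... | no a     | no b     | _        | _        = inj₂ (inj₁ (a , b))
... | _        | _        | no a     | no b     = inj₂ (inj₂ (a , b))
... | yes refl | _        | yes refl | _        = ⊥-elim (j′≢k′ refl)
... | no _     | yes refl | no _     | yes refl = ⊥-elim (j′≢k′ refl)
... | yes refl | _        | no _     | yes refl = inj₁ (λ on i i≢j i≢k → on i i≢j i≢k)
... | no _     | yes refl | yes refl | _        = inj₁ (λ on i i≢k i≢j → on i i≢j i≢k)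

-- Shadows

shadow-mono : ∀ {d n} {A A′ : List (Point d)} {x : Point d} →
              (∀ {y} → y ∈ A → y ∈ A′) → InShadow n A x → InShadow n A′ x
shadow-mono sub (s , y , y∈A , x≤y) = s , y , sub y∈A , x≤y

decAt : ∀ {d} → Point d → Fin d → Point d
decAt x k = updateAt x k pred

sum-decAt : ∀ {d} (x : Point d) (k : Fin d) → 1 ≤ lookup x k → sum (decAt x k) + 1 ≡ sum x
sum-decAt (suc a ∷ x) zero    _ = +-comm (a + sum x) 1
sum-decAt (a ∷ x)     (suc k) h = trans (+-assoc a (sum (decAt x k)) 1) (cong (a +_) (sum-decAt x k h))

decAt-≤ : ∀ {d} (x : Point d) (k : Fin d) → decAt x k ≤ᵖ x
decAt-≤ x k i with i ≟ᶠ k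
... | yes refl = subst (_≤ lookup x k) (sym (lookup∘updateAt k x)) pred[n]≤n
... | no i≢k   = ≤-reflexive (lookup∘updateAt′ i k i≢k x)

decAt-unit : ∀ {d} (k : Fin d) (c : ℕ) → decAt (unit k (suc c)) k ≡ unit k c
decAt-unit zero    c = refl
decAt-unit (suc k) c = cong (0 ∷_) (decAt-unit k c)

decAt-shadow : ∀ {d n} {A : List (Point d)} {x : Point d} (k : Fin d) →
               x ∈ A → InLayer n x → 1 ≤ lookup x k → InShadow n A (decAt x k)
decAt-shadow {x = x} k x∈A layer pos = trans (sum-decAt x k pos) layer , x , x∈A , decAt-≤ x k

two-shadows : ∀ {d n} {A : List (Point d)} {x : Point d} {k k′ : Fin d} → k ≢ k′ →
              x ∈ A → InLayer n x → 1 ≤ lookup x k → 1 ≤ lookup x k′ → AtLeast (InShadow n A) 2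
two-shadows {x = x} {k} {k′} k≢k′ x∈A layer pos pos′ =
  decAt x k ∷ decAt x k′ ∷ [] ,
  unique-∷ (λ { (here e) → differ e }) (unique-∷ (λ ()) []) ,
  decAt-shadow k x∈A layer pos ∷ decAt-shadow k′ x∈A layer pos′ ∷ [] ,
  ≤-refl
  where
  -- the two points differ in coordinate k, where they are x_k − 1 and x_k
  differ : decAt x k ≢ decAt x k′
  differ e = <⇒≢ (pred-< pos) (begin
    pred (lookup x k)        ≡⟨ lookup∘updateAt k x ⟨
    lookup (decAt x k) k     ≡⟨ cong (λ y → lookup y k) e ⟩
    lookup (decAt x k′) k    ≡⟨ lookup∘updateAt′ k k′ k≢k′ x ⟩
    lookup x k               ∎)
    where
    open ≡-Reasoning
    pred-< : ∀ {a} → 1 ≤ a → pred a < a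
    pred-< (s≤s z≤n) = ≤-refl

-- Splitting a set of points by its first coordinate

base : ∀ {d} → List (Point (suc d)) → List (Point d)
base []                  = []
base ((zero  ∷ y) ∷ B) = y ∷ base B
base ((suc _ ∷ _) ∷ B) = base B

lowered : ∀ {d} → List (Point (suc d)) → List (Point (suc d))
lowered []                  = []
lowered ((zero  ∷ _) ∷ B) = lowered B
lowered ((suc a ∷ y) ∷ B) = (a ∷ y) ∷ lowered B

module _ {d : ℕ} where

  ∈-base⁺ : ∀ {B : List (Point (suc d))} {y} → (0 ∷ y) ∈ B → y ∈ base B
  ∈-base⁺ {(zero  ∷ _) ∷ B} (here refl) = here refl
  ∈-base⁺ {(zero  ∷ _) ∷ B} (there m)   = there (∈-base⁺ m)
  ∈-base⁺ {(suc _ ∷ _) ∷ B} (there m)   = ∈-base⁺ m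

  ∈-base⁻ : ∀ {B : List (Point (suc d))} {y} → y ∈ base B → (0 ∷ y) ∈ B
  ∈-base⁻ {(zero  ∷ _) ∷ B} (here refl) = here refl
  ∈-base⁻ {(zero  ∷ _) ∷ B} (there m)   = there (∈-base⁻ m)
  ∈-base⁻ {(suc _ ∷ _) ∷ B} m           = there (∈-base⁻ m)

  ∈-lowered⁻ : ∀ {B : List (Point (suc d))} {a y} → (a ∷ y) ∈ lowered B → (suc a ∷ y) ∈ B
  ∈-lowered⁻ {(zero  ∷ _) ∷ B} m           = there (∈-lowered⁻ m)
  ∈-lowered⁻ {(suc _ ∷ _) ∷ B} (here refl) = here refl
  ∈-lowered⁻ {(suc _ ∷ _) ∷ B} (there m)   = there (∈-lowered⁻ m)

  unique-base : ∀ {B : List (Point (suc d))} → Unique B → Unique (base B)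
  unique-base {[]}                  _       = []
  unique-base {(zero  ∷ _) ∷ B} (h ∷ u) = unique-∷ (λ m → All.lookup h (∈-base⁻ m) refl) (unique-base u)
  unique-base {(suc _ ∷ _) ∷ B} (_ ∷ u) = unique-base u

  unique-lowered : ∀ {B : List (Point (suc d))} → Unique B → Unique (lowered B)
  unique-lowered {[]}                  _       = []
  unique-lowered {(zero  ∷ _) ∷ B} (_ ∷ u) = unique-lowered u
  unique-lowered {(suc _ ∷ _) ∷ B} (h ∷ u) = unique-∷ (λ m → All.lookup h (∈-lowered⁻ m) refl) (unique-lowered u)

  layer-base : ∀ {n} {B : List (Point (suc d))} → All (InLayer n) B → All (InLayer n) (base B)
  layer-base {B = []}                  _        = []
  layer-base {B = (zero  ∷ _) ∷ B} (s ∷ ls) = s ∷ layer-base ls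
  layer-base {B = (suc _ ∷ _) ∷ B} (_ ∷ ls) = layer-base ls

  layer-lowered : ∀ {n} {B : List (Point (suc d))} → All (InLayer (suc n)) B → All (InLayer n) (lowered B)
  layer-lowered {B = []}                  _        = []
  layer-lowered {B = (zero  ∷ _) ∷ B} (_ ∷ ls) = layer-lowered ls
  layer-lowered {B = (suc _ ∷ _) ∷ B} (s ∷ ls) = suc-injective s ∷ layer-lowered ls

  length-split : (B : List (Point (suc d))) → length B ≡ length (base B) + length (lowered B)
  length-split []                  = refl
  length-split ((zero  ∷ _) ∷ B) = cong suc (length-split B)
  length-split ((suc _ ∷ _) ∷ B) = trans (cong suc (length-split B)) (sym (+-suc _ _))

  base-line : ∀ {n} {j k : Fin d} {B : List (Point (suc d))} → Line j k n (base B) → Line (suc j) (suc k) n B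
  base-line line (a ∷ y) layer on with on zero (λ ()) (λ ())
  ... | refl = ∈-base⁻ (line y layer (λ i i≢j i≢k → on (suc i) (i≢j ∘ Fin.suc-injective) (i≢k ∘ Fin.suc-injective)))

  line-base : ∀ {n} {j k : Fin d} {B : List (Point (suc d))} → Line (suc j) (suc k) n B → Line j k n (base B)
  line-base line y layer on = ∈-base⁺ (line (0 ∷ y) layer on′)
    where
    on′ : OnLine (suc _) (suc _) (0 ∷ y)
    on′ zero    _   _   = refl
    on′ (suc i) i≢j i≢k = on i (i≢j ∘ cong suc) (i≢k ∘ cong suc)

  corner-line : ∀ {n} {k : Fin d} {A : List (Point (suc d))} →
                (∀ a → a ≤ n → linePt zero (suc k) a (n ∸ a) ∈ A) → Line zero (suc k) n A
  corner-line {n} {k} {A} points (a ∷ y) layer on = subst (_∈ A) (cong (a ∷_) (sym y≡)) (points a a≤n)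
    where
    a≤n : a ≤ n
    a≤n = subst (a ≤_) layer (m≤m+n a (sum y))
    y≡ : y ≡ unit k (n ∸ a)
    y≡ = trans (single-support k y (λ i i≢k → on (suc i) (λ ()) (i≢k ∘ Fin.suc-injective)))
               (cong (unit k) (trans (sym (m+n∸m≡n a (sum y))) (cong (_∸ a) layer)))

module ShadowSplit {d m : ℕ} (B : List (Point (suc d))) (layerB : All (InLayer (suc m)) B) where

  private
    layerU : All (InLayer m) (lowered B)
    layerU = layer-lowered layerB

  -- y with (0,y) ∈ ∂B for one of two reasons: y ∈ ∂(base B), or (0,y) ∈ U, which lies below (1,y) ∈ B.
  BaseShadow : Point d → Set
  BaseShadow y = InShadow (suc m) (base B) y ⊎ y ∈ base (lowered B)

  baseShadow⊆ : ∀ {y} → BaseShadow y → InShadow (suc m) B (0 ∷ y)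
  baseShadow⊆ (inj₁ (s , z , z∈S , y≤z)) = s , 0 ∷ z , ∈-base⁻ z∈S , ≤ᵖ-∷ z≤n y≤z
  baseShadow⊆ {y} (inj₂ y∈) =
    trans (+-comm (sum y) 1) (cong suc (All.lookup layerU (∈-base⁻ y∈))) ,
    1 ∷ y , ∈-lowered⁻ (∈-base⁻ y∈) , ≤ᵖ-∷ z≤n (≤ᵖ-refl y)

  raise : Point (suc d) → Point (suc d)
  raise (a ∷ y) = suc a ∷ y

  loweredShadow⊆ : ∀ {x} → InShadow m (lowered B) x → InShadow (suc m) B (raise x)
  loweredShadow⊆ {a ∷ y} (s , b ∷ z , z∈U , x≤z) =
    cong suc s , suc b ∷ z , ∈-lowered⁻ z∈U , λ { zero → s≤s (x≤z zero) ; (suc i) → x≤z (suc i) }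

  lowered⊆ : ∀ {x} → x ∈ lowered B → InShadow (suc m) B x
  lowered⊆ {a ∷ y} x∈U =
    trans (+-comm (sum (a ∷ y)) 1) (cong suc (All.lookup layerU x∈U)) ,
    suc a ∷ y , ∈-lowered⁻ x∈U , ≤ᵖ-∷ (n≤1+n a) (≤ᵖ-refl y)

  -- |∂B| ≥ |BaseShadow| + |∂U|: the two parts are told apart by the first coordinate.
  shadow-split : ∀ {a b} → AtLeast BaseShadow a → AtLeast (InShadow m (lowered B)) b →
                 ShadowSizeAtLeast (suc m) B (a + b)
  shadow-split {a} {b} sa sb = atLeast-mono (λ {x} → forget {x}) (atLeast-union (λ {x} → apart {x}) onBase onTop)
    where
    OnBase OnTop : Point (suc d) → Set
    OnBase x = lookup x zero ≡ 0 × InShadow (suc m) B x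
    OnTop  x = 1 ≤ lookup x zero × InShadow (suc m) B x
    onBase : AtLeast OnBase a
    onBase = atLeast-image (0 ∷_) (cong tail) (λ p → refl , baseShadow⊆ p) sa
    onTop : AtLeast OnTop b
    onTop = atLeast-image raise (λ { {_ ∷ _} {_ ∷ _} refl → refl })
                          (λ { {_ ∷ _} p → s≤s z≤n , loweredShadow⊆ p }) sb
    apart : ∀ {x} → OnBase x → OnTop x → ⊥
    apart (x₀≡0 , _) (1≤x₀ , _) = 1+n≰n (subst (1 ≤_) x₀≡0 1≤x₀)
    forget : ∀ {x} → OnBase x ⊎ OnTop x → InShadow (suc m) B x
    forget (inj₁ (_ , s)) = s
    forget (inj₂ (_ , s)) = s

_∈?_ : ∀ {d} (x : Point d) (A : List (Point d)) → Dec (x ∈ A)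
_∈?_ = DecMembership._∈?_ (≡-dec _≟_)

member : ∀ {X : Set} {xs : List X} → 1 ≤ length xs → ∃ λ x → x ∈ xs
member {xs = x ∷ _} _ = x , here refl

n≤1+pred[n] : ∀ n → n ≤ suc (pred n)
n≤1+pred[n] zero    = z≤n
n≤1+pred[n] (suc n) = ≤-refl

first-exit : {P : ℕ → Set} → Decidable P → ∀ N → P 0 →
             (∀ a → a ≤ N → P a) ⊎ (∃[ a ] (a < N × P a × ¬ P (suc a)))
first-exit P? zero    p₀ = inj₁ λ { _ z≤n → p₀ }
first-exit P? (suc N) p₀ with first-exit P? N p₀
... | inj₂ (a , a<N , pa , ¬pa′) = inj₂ (a , m<n⇒m<1+n a<N , pa , ¬pa′)
... | inj₁ upto-N with P? (suc N)
...   | no ¬p = inj₂ (N , n<1+n N , upto-N N ≤-refl , ¬p)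
...   | yes p = inj₁ λ a a≤1+N → [ (λ a<1+N → upto-N a (s≤s⁻¹ a<1+N)) , (λ { refl → p }) ]′ (m≤n⇒m<n∨m≡n a≤1+N)

data Support {d} (x : Point d) : Set where
  origin : (∀ i → lookup x i ≡ 0) → Support x
  single : (k : Fin d) → (∀ i → i ≢ k → lookup x i ≡ 0) → Support x
  double : (k k′ : Fin d) → k ≢ k′ → 1 ≤ lookup x k → 1 ≤ lookup x k′ → Support x

support : ∀ {d} (x : Point d) → Support x
support []      = origin (λ ())
support (a ∷ x) with support x
... | origin h = single zero (λ { zero i≢0 → ⊥-elim (i≢0 refl) ; (suc i) _ → h i })
... | double k k′ k≢k′ p p′ = double (suc k) (suc k′) (k≢k′ ∘ Fin.suc-injective) p p′
... | single k h with a ≟ 0 | lookup x k ≟ 0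
...   | yes refl | _        = single (suc k) (λ { zero _ → refl ; (suc i) i≢k → h i (i≢k ∘ cong suc) })
...   | no a≢0   | no xₖ≢0  = double zero (suc k) (λ ()) (n≢0⇒n>0 a≢0) (n≢0⇒n>0 xₖ≢0)
...   | no _     | yes xₖ≡0 = single zero (λ { zero i≢0 → ⊥-elim (i≢0 refl) ; (suc i) _ → vanish i })
  where
  vanish : ∀ i → lookup x i ≡ 0
  vanish i with i ≟ᶠ k
  ... | yes refl = xₖ≡0
  ... | no i≢k   = h i i≢k

Claim : ℕ → ℕ → Set
Claim n d = (A : List (Point d)) → IsSubsetOfLayer n A → length A < 2 * n →
            ShadowSizeAtLeast n A (length A) ⊎ ContainsLine n A

claim-without : ∀ {m D} {A : List (Point D)} {u : Point D} → Claim m D →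
                Unique A → All (InLayer m) A → length A ≤ 2 * m → (p : u ∈ A) →
                AtLeast (InShadow m A) (pred (length A)) ⊎ ContainsLine m (A ─ p)
claim-without {A = A} ih uniqueA layerA |A|≤2m p
  with ih (A ─ p) (unique-─ uniqueA p , AllP.─⁺ p layerA) (subst (_≤ _) (length-removeAt′ A (index p)) |A|≤2m)
... | inj₂ line   = inj₂ line
... | inj₁ shadow = inj₁ (subst (AtLeast _) (cong pred (sym (length-removeAt′ A (index p))))
                              (atLeast-mono (λ {x} → shadow-mono {x = x} (∈-─⁻ p)) shadow))

-- A line in A minus a point u of a line of A is a second line, so |A| ≥ 2m+1.
second-line : ∀ {m D} {A : List (Point D)} {j k : Fin D} {u : Point D} → Unique A → j ≢ k →
              Line j k m A → LinePoint j k m u → (p : u ∈ A) → ContainsLine m (A ─ p) → suc m + m ≤ length A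
second-line {j = j} {k} {u} uniqueA j≢k line (layer , on) p (j′ , k′ , j′≢k′ , line′) with pair-cases j k j′ k′ j′≢k′
... | inj₁ same          = ⊥-elim (∉-─ uniqueA p (line′ u layer (same {u} on)))
... | inj₂ (inj₁ (a , b)) = two-lines j≢k j′≢k′ a b line (line-⊆ (∈-─⁻ p) line′)
... | inj₂ (inj₂ (a , b)) = two-lines j≢k (j′≢k′ ∘ sym) a b line (line-⊆ (∈-─⁻ p) (line-swap line′))

2m+1≰2m : ∀ {m n} → suc m + m ≤ n → n ≤ 2 * m → ⊥
2m+1≰2m {m} {n} h n≤2m = 1+n≰n (≤-trans h (subst (n ≤_) (cong (m +_) (+-identityʳ m)) n≤2m))

-- If A ⊂ ℤ^D(m) contains a line and |A| ≤ 2m, then |∂A| ≥ |A| − 1: apply the claim to A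
-- minus the point m·e_k of the line; a line there would be a second line of A.
line-shadow : ∀ {m D} {A : List (Point D)} {j k : Fin D} → Claim m D →
              Unique A → All (InLayer m) A → length A ≤ 2 * m → j ≢ k → Line j k m A →
              AtLeast (InShadow m A) (pred (length A))
line-shadow {m} {D} {A} {j} {k} ih uniqueA layerA |A|≤2m j≢k line = remove (line u (proj₁ u-on) (proj₂ u-on))
  where
  u : Point D
  u = linePt j k 0 m
  u-on : LinePoint j k m u
  u-on = linePt-layer j k z≤n , linePt-onLine j k
  remove : (p : u ∈ A) → AtLeast (InShadow m A) (pred (length A))
  remove p with claim-without ih uniqueA layerA |A|≤2m p
  ... | inj₁ shadow = shadow
  ... | inj₂ line′  = ⊥-elim (2m+1≰2m {m} (second-line uniqueA j≢k line u-on p line′) |A|≤2m)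

module InductiveStep {d m : ℕ} (claim-lowered : Claim m (suc d)) (claim-base : Claim (suc m) d)
  (B : List (Point (suc d))) (uniqueB : Unique B) (layerB : All (InLayer (suc m)) B)
  (small : length B < 2 * suc m) where

  open ShadowSplit B layerB

  S : List (Point d)
  S = base B

  U : List (Point (suc d))
  U = lowered B

  uniqueS : Unique S
  uniqueS = unique-base uniqueB

  uniqueU : Unique U
  uniqueU = unique-lowered uniqueB

  layerS : All (InLayer (suc m)) S
  layerS = layer-base layerB

  layerU : All (InLayer m) U
  layerU = layer-lowered layerB

  Goal : Set
  Goal = ShadowSizeAtLeast (suc m) B (length B) ⊎ ContainsLine (suc m) B

  split : length B ≡ length S + length U
  split = length-split B

  bound : length S + length U ≤ suc (2 * m)
  bound = subst (_≤ suc (2 * m)) split (s≤s⁻¹ (subst (suc (length B) ≤_) (*-suc 2 m) small))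

  S-small : length S < 2 * suc m
  S-small = ≤-<-trans (m≤m+n (length S) (length U)) (subst (_< 2 * suc m) split small)

  U≤2m : 1 ≤ length S → length U ≤ 2 * m
  U≤2m 1≤β = s≤s⁻¹ (≤-trans (+-monoˡ-≤ (length U) 1≤β) bound)

  S≤m : suc m ≤ length U → length S ≤ m
  S≤m m<μ = +-cancelʳ-≤ (suc m) (length S) m (begin
    length S + suc m        ≤⟨ +-monoʳ-≤ (length S) m<μ ⟩
    length S + length U     ≤⟨ bound ⟩
    suc (m + (m + 0))       ≡⟨ cong (λ n → suc (m + n)) (+-identityʳ m) ⟩
    suc (m + m)             ≡⟨ +-suc m m ⟨
    m + suc m               ∎)
    where open ≤-Reasoning

  S+1≤2m+2 : length S ≤ m → suc (length S) < 2 * suc m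
  S+1≤2m+2 β≤m = subst (suc (suc (length S)) ≤_) (sym (*-suc 2 m))
                       (s≤s (s≤s (≤-trans β≤m (m≤m+n m (m + 0)))))

  one-less : ∀ {a} → length S ≤ a → length S + length U ≤ suc a + pred (length U)
  one-less {a} β≤a = subst (length S + length U ≤_) (+-suc a (pred (length U)))
                           (+-mono-≤ β≤a (n≤1+pred[n] (length U)))

  finish : ∀ {a b} → AtLeast BaseShadow a → AtLeast (InShadow m U) b → length S + length U ≤ a + b → Goal
  finish sa sb enough = inj₁ (atLeast-weaken (subst (_≤ _) (sym split) enough) (shadow-split sa sb))

  -- Case S = ∅: U ⊆ ∂B already has |B| points.
  no-base : length S ≡ 0 → Goal
  no-base β≡0 = inj₁ (U , uniqueU , All.tabulate lowered⊆ , ≤-reflexive (trans split (cong (_+ length U) β≡0)))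

  -- Case |∂U| ≥ |U|: the claim for S finishes the proof.
  via-shadow-of-U : AtLeast (InShadow m U) (length U) → Goal
  via-shadow-of-U sU with claim-base S (uniqueS , layerS) S-small
  ... | inj₁ sS = finish (atLeast-mono inj₁ sS) sU ≤-refl
  ... | inj₂ (j , k , j≢k , line) = inj₂ (suc j , suc k , j≢k ∘ Fin.suc-injective , base-line line)

  -- A line of U avoiding coordinate 0 lies in the face x₀ = 0 of U: m+1 points of BaseShadow.
  flat-case : 1 ≤ length S → {j k : Fin d} → j ≢ k → Line (suc j) (suc k) m U → Goal
  flat-case 1≤β j≢k line =
    finish (atLeast-mono inj₂ (line-atLeast j≢k (line-base line)))
           (line-shadow claim-lowered uniqueU layerU (U≤2m 1≤β) (j≢k ∘ Fin.suc-injective) line)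
           (one-less (S≤m (line-size (j≢k ∘ Fin.suc-injective) line)))

  corner-extends : (k : Fin d) → Line zero (suc k) m U → (0 ∷ unit k (suc m)) ∈ B → ContainsLine (suc m) B
  corner-extends k line vertex∈B = zero , suc k , (λ ()) , corner-line points
    where
    points : ∀ a → a ≤ suc m → linePt zero (suc k) a (suc m ∸ a) ∈ B
    points zero    _     = vertex∈B
    points (suc a) a<1+m = ∈-lowered⁻ (line _ (linePt-layer zero (suc k) (s≤s⁻¹ a<1+m)) (linePt-onLine zero (suc k)))

  -- With that line in U, a point of ∂(S ∪ {(m+1)·e_k}) is in BaseShadow: either it lies in ∂S,
  -- or it lies below the vertex, hence is m·e_k, and (0, m·e_k) ∈ U.
  corner-base-shadow : (k : Fin d) → Line zero (suc k) m U →
                       ∀ {y} → InShadow (suc m) (unit k (suc m) ∷ S) y → BaseShadow y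
  corner-base-shadow k line (s , z , there z∈S , y≤z) = inj₁ (s , z , z∈S , y≤z)
  corner-base-shadow k line {y} (s , _ , here refl , y≤v) = inj₂ (∈-base⁺ (line (0 ∷ y) layer on))
    where
    layer : sum y ≡ m
    layer = suc-injective (trans (+-comm 1 (sum y)) s)
    on : OnLine zero (suc k) (0 ∷ y)
    on zero    _ _   = refl
    on (suc i) _ i≢k = n≤0⇒n≡0 (subst (lookup y i ≤_) (lookup-unit-other (suc m) (i≢k ∘ cong suc)) (y≤v i))

  -- A line of U in coordinates 0, k+1: either B contains the extended line, or the claim for
  -- S ∪ {(m+1)·e_k} gives |S| + 1 base shadow points (it cannot contain a line: it has ≤ m+1 points).
  corner-case : 1 ≤ length S → (k : Fin d) → Line zero (suc k) m U → Goal
  corner-case 1≤β k line with (0 ∷ unit k (suc m)) ∈? B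
  ... | yes vertex∈B = inj₂ (corner-extends k line vertex∈B)
  ... | no vertex∉B with claim-base (unit k (suc m) ∷ S) (unique-∷ (vertex∉B ∘ ∈-base⁻) uniqueS , sum-unit k (suc m) ∷ layerS)
                                    (S+1≤2m+2 (S≤m (line-size (λ ()) line)))
  ...   | inj₁ sS′ = finish (atLeast-mono (corner-base-shadow k line) sS′)
                            (line-shadow claim-lowered uniqueU layerU (U≤2m 1≤β) (λ ()) line) (one-less ≤-refl)
  ...   | inj₂ (_ , _ , j′≢k′ , line′) = ⊥-elim (1+n≰n (≤-trans (s≤s⁻¹ (line-size j′≢k′ line′)) (S≤m (line-size (λ ()) line))))

  via-line-in-U : 1 ≤ length S → (j k : Fin (suc d)) → j ≢ k → Line j k m U → Goal
  via-line-in-U _   zero    zero    j≢k _    = ⊥-elim (j≢k refl)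
  via-line-in-U 1≤β zero    (suc k) _   line = corner-case 1≤β k line
  via-line-in-U 1≤β (suc j) zero    _   line = corner-case 1≤β j (line-swap line)
  via-line-in-U 1≤β (suc j) (suc k) j≢k line = flat-case 1≤β (j≢k ∘ cong suc) line

  exit-point : (k : Fin d) (a : ℕ) → a ≤ m → linePt zero (suc k) a (suc m ∸ a) ∈ B →
               linePt zero (suc k) (suc a) (m ∸ a) ∉ B →
               InShadow (suc m) B (linePt zero (suc k) a (m ∸ a)) × linePt zero (suc k) a (m ∸ a) ∉ U
  exit-point k a a≤m q∈B q′∉B = subst (InShadow (suc m) B) lowered-q (decAt-shadow (suc k) q∈B layer pos) ,
                                 q′∉B ∘ ∈-lowered⁻
    where
    layer : InLayer (suc m) (linePt zero (suc k) a (suc m ∸ a))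
    layer = linePt-layer zero (suc k) (m≤n⇒m≤1+n a≤m)
    pos : 1 ≤ lookup (unit k (suc m ∸ a)) k
    pos = subst (1 ≤_) (sym (lookup-unit-same k (suc m ∸ a))) (m<n⇒0<n∸m (s≤s a≤m))
    lowered-q : a ∷ decAt (unit k (suc m ∸ a)) k ≡ a ∷ unit k (m ∸ a)
    lowered-q = cong (a ∷_) (trans (cong (λ c → decAt (unit k c) k) (+-∸-assoc 1 a≤m)) (decAt-unit k (m ∸ a)))

  -- S = {(m+1)·e_k}: walk along the line in coordinates 0, k+1 from the vertex (0, (m+1)·e_k) ∈ B;
  -- either the whole line is in B, or the first exit gives a point of ∂B outside U.
  vertex-case : (k : Fin d) → (0 ∷ unit k (suc m)) ∈ B → length S + length U ≤ suc (length U) → Goal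
  vertex-case k vertex∈B β≤1 with first-exit (λ a → linePt zero (suc k) a (suc m ∸ a) ∈? B) (suc m) vertex∈B
  ... | inj₁ all = inj₂ (zero , suc k , (λ ()) , corner-line all)
  ... | inj₂ (a , a<1+m , q∈B , q′∉B) with exit-point k a (s≤s⁻¹ a<1+m) q∈B q′∉B
  ...   | y∈∂B , y∉U = inj₁ (_ ∷ U , unique-∷ y∉U uniqueU , y∈∂B ∷ All.tabulate lowered⊆ ,
                             subst (_≤ suc (length U)) (sym split) β≤1)

  -- S = {t} (and |∂U| ≥ |U| − 1): two base shadow points if t has two positive coordinates,
  -- otherwise t is a vertex.
  single-base : 1 ≤ length S → length S + length U ≤ suc (length U) → AtLeast (InShadow m U) (pred (length U)) → Goal
  single-base 1≤β β≤1 sU with member 1≤β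
  ... | t , t∈S with support t
  ...   | origin h = ⊥-elim (0≢1+n (trans (sym (sum-all-zero t h)) (All.lookup layerS t∈S)))
  ...   | double k k′ k≢k′ p p′ = finish (atLeast-mono inj₁ (two-shadows k≢k′ t∈S (All.lookup layerS t∈S) p p′)) sU
                                          (one-less (+-cancelʳ-≤ (length U) (length S) 1 β≤1))
  ...   | single k h = vertex-case k (subst (λ x → (0 ∷ x) ∈ B) t≡vertex (∈-base⁻ t∈S)) β≤1
    where
    t≡vertex : t ≡ unit k (suc m)
    t≡vertex = trans (single-support k t h) (cong (unit k) (All.lookup layerS t∈S))

  -- Case |U| ≥ 2m (and S ≠ ∅): then |S| = 1; apply the claim to U minus one point.
  crowded : 1 ≤ length S → 2 * m ≤ length U → Goal
  crowded 1≤β 2m≤μ with length U ≟ 0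
  ... | yes μ≡0 = via-shadow-of-U ([] , [] , [] , ≤-reflexive μ≡0)
  ... | no μ≢0 with member (n≢0⇒n>0 μ≢0)
  ...   | u , u∈U with claim-without claim-lowered uniqueU layerU (U≤2m 1≤β) u∈U
  ...     | inj₁ sU = single-base 1≤β (≤-trans bound (s≤s 2m≤μ)) sU
  ...     | inj₂ (j , k , j≢k , line) = via-line-in-U 1≤β j k j≢k (line-⊆ (∈-─⁻ u∈U) line)

  step : Goal
  step with length S ≟ 0 | length U <? 2 * m
  ... | yes β≡0 | _       = no-base β≡0
  ... | no β≢0  | no μ≮2m = crowded (n≢0⇒n>0 β≢0) (≮⇒≥ μ≮2m)
  ... | no β≢0  | yes μ<2m with claim-lowered U (uniqueU , layerU) μ<2m
  ...   | inj₁ sU                   = via-shadow-of-U sU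
  ...   | inj₂ (j , k , j≢k , line) = via-line-in-U (n≢0⇒n>0 β≢0) j k j≢k line

lemma3p1 : (n d : ℕ) (A : List (Point d)) → IsSubsetOfLayer n A →
    length A < 2 * n →
    ShadowSizeAtLeast n A (length A) ⊎ ContainsLine n A
lemma3p1 zero    d       A         _               ()
lemma3p1 (suc m) zero    []        _               _     = inj₁ ([] , [] , [] , z≤n)
lemma3p1 (suc m) zero    ([] ∷ _) (_ , () ∷ _)    _
lemma3p1 (suc m) (suc d) B         (uniqueB , layerB) small =
  InductiveStep.step (lemma3p1 m (suc d)) (lemma3p1 (suc m) d) B uniqueB layerB small
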